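{- Let $n\ge 2$ targets $\mathcal T=\{1,\dots,n\}$ be given with travel times $c(u,v)>0$ ($u\ne v$) satisfying the triangle inequality. For every integer $k$ with $n\le k\le 2n-2$, $\mathcal R^*(k)\le \mathcal R^*(k+1)$.
   Context: Targets $\mathcal T=\{1,\dots,n\}$, $n\ge 2$; travel times $c(u,v)>0$ for distinct $u,v\in\mathcal T$ (set $c(u,u)=0$), satisfying $c(u,v)+c(v,w)\ge c(u,w)$ for all $u,v,w\in\mathcal T$. For an integer $k\ge n$, a closed walk with $k$ visits is a sequence $\mathcal W=(v_1,\dots,v_{k+1})$ of targets with $v_{k+1}=v_1$, $v_i\ne v_{i+1}$ for $1\le i\le k$, and every target appearing among $v_1,\dots,v_k$. The walk is repeated forever: extend it to the infinite periodic sequence $(v_i)_{i\ge 1}$ with $v_{i+k}=v_i$, where moving from $v_i$ to $v_{i+1}$ takes time $c(v_i,v_{i+1})$. For a target $d$, the revisit time $RT(d,\mathcal W)$ is the maximum, over all pairs of indices $i<j$ with $v_i=v_j=d$ and $v_l\ne d$ for $i<l<j$, of $\sum_{l=i}^{j-1}c(v_l,v_{l+1})$. The revisit time of the walk is $\mathcal R(\mathcal W)=\max_{d\in\mathcal T}RT(d,\mathcal W)$, and $\mathcal R^*(k)$ is the minimum of $\mathcal R(\mathcal W)$ over all closed walks with $k$ visits (with the convention $\mathcal R^*(k)=+\infty$ if no such walk exists).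
   Formalization: The travel times $c(u,v)$ take values in the rationals. -}

module Defs where

open import Data.Nat using (ℕ; zero; suc; _<_) renaming (_+_ to _+ℕ_)
open import Data.Fin using (Fin)
open import Data.Rational using (ℚ; 0ℚ; _+_; _≤_)
open import Data.Product using (∃; _×_)
open import Relation.Binary.PropositionalEquality using (_≡_; _≢_)

-- A closed walk with k visits on targets Fin n, given directly as its
-- infinite periodic extension (0-based indexing: seq 0 = v_1, …,
-- seq (k-1) = v_k, seq k = v_{k+1} = v_1, and seq (i + k) = seq i).
record ClosedWalk (n k : ℕ) : Set where
  field
    seq        : ℕ → Fin n
    periodic   : ∀ i → seq (i +ℕ k) ≡ seq i
    noStay     : ∀ i → i < k → seq i ≢ seq (suc i)
    covers     : ∀ (d : Fin n) → ∃ λ i → i < k × seq i ≡ d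
open ClosedWalk public

pathCost : ∀ {n} → (Fin n → Fin n → ℚ) → (ℕ → Fin n) → ℕ → ℕ → ℚ
pathCost c s i zero    = 0ℚ
pathCost c s i (suc m) = c (s i) (s (suc i)) + pathCost c s (suc i) m

-- RevisitBound c W r  ⇔  R(W) ≤ r, i.e. every revisit time RT(d,W) ≤ r:
-- for all consecutive occurrences i < j = i + g of a target d in the
-- infinite walk, the travel time between them is at most r.
RevisitBound : ∀ {n k} → (Fin n → Fin n → ℚ) → ClosedWalk n k → ℚ → Set
RevisitBound {n} c W r =
  ∀ (d : Fin n) (i g : ℕ) → 0 < g →
  seq W i ≡ d → seq W (i +ℕ g) ≡ d →
  (∀ l → 0 < l → l < g → seq W (i +ℕ l) ≢ d) →
  pathCost c (seq W) i g ≤ r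

-- R*(k) ≤ R*(k') (with R* = +∞ when no walk exists): every walk with k'
-- visits is matched by a walk with k visits of no larger revisit time.
-- (Revisit times are maxima over finitely many values, hence attained, so
-- "∀ r, R(W') ≤ r → R(W) ≤ r" is exactly R(W) ≤ R(W').)
OptRevisitLe : ∀ {n} → (Fin n → Fin n → ℚ) → ℕ → ℕ → Set
OptRevisitLe {n} c k k' =
  (W' : ClosedWalk n k') → ∃ λ (W : ClosedWalk n k) →
    ∀ r → RevisitBound c W' r → RevisitBound c W r

{-# OPTIONS --safe #-}
-- Write K = k + 1 for the number of visits of a walk W′. Since n < K < 2n, some target is visited
-- twice per period (pigeonhole) and some target only once (else K would contain 2n positions).
-- Hence along W′ there is a position p whose target is visited once per period while the target
-- at p + 1 recurs. Deleting the visit at p + 1 leaves a closed walk with k visits: every target is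
-- still visited, and the targets at p and p + 2 differ. By the triangle inequality its period cost
-- is at most that of W′, which is exactly the revisit time of the once-visited target at p; and in
-- any walk every revisit time is at most the period cost.

module Submission where

open import Defs
open import Data.Nat using (ℕ; suc; _*_; _∸_) renaming (_≤_ to _≤ℕ_)
open import Data.Fin using (Fin)
open import Data.Rational using (ℚ; 0ℚ; _+_; _≤_; _<_)
open import Relation.Binary.PropositionalEquality using (_≡_; _≢_)

open import Data.Nat using (zero; pred; NonZero; >-nonZero⁻¹; z≤n; s≤s; s≤s⁻¹; _<?_; _≤?_)
  renaming (_+_ to _+ℕ_; _<_ to _<ℕ_)
open import Data.Nat.DivMod
  using (_%_; _/_; m≡m%n+[m/n]*n; m%n<n; m<n⇒m%n≡m; [m+n]%n≡m%n; m≤n⇒[n∸m]%m≡n%m)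
import Data.Nat.Properties as ℕ
import Data.Rational.Properties as ℚ
open import Algebra.Properties.Group ℚ.+-0-group using (∙-cancelˡ)
open import Data.Fin using (toℕ; fromℕ<; splitAt)
import Data.Fin.Properties as Fin
open import Data.Product using (∃; _×_; _,_; proj₁; proj₂)
open import Data.Sum using (_⊎_; inj₁; inj₂; reduce)
open import Data.Empty using (⊥-elim)
open import Function using (_∘_)
open import Function.Bundles using (Injection)
open import Function.Properties.Inverse using (↔⇒↣)
open import Relation.Nullary using (¬_; yes; no)
open import Relation.Nullary.Decidable using (_×-dec_; ¬?; decidable-stable)
open import Relation.Unary using (Decidable)
open import Relation.Binary.PropositionalEquality
  using (refl; sym; trans; cong; cong₂; subst; module ≡-Reasoning)

module _ {n : ℕ} (c : Fin n → Fin n → ℚ) where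

  pathCost-+ : ∀ s i a b → pathCost c s i (a +ℕ b) ≡ pathCost c s i a + pathCost c s (i +ℕ a) b
  pathCost-+ s i zero b =
    sym (trans (ℚ.+-identityˡ _) (cong (λ j → pathCost c s j b) (ℕ.+-identityʳ i)))
  pathCost-+ s i (suc a) b = begin
    step + pathCost c s (suc i) (a +ℕ b)
      ≡⟨ cong (step +_) (pathCost-+ s (suc i) a b) ⟩
    step + (pathCost c s (suc i) a + pathCost c s (suc i +ℕ a) b)
      ≡⟨ ℚ.+-assoc step (pathCost c s (suc i) a) (pathCost c s (suc i +ℕ a) b) ⟨
    (step + pathCost c s (suc i) a) + pathCost c s (suc i +ℕ a) b
      ≡⟨ cong (λ j → (step + pathCost c s (suc i) a) + pathCost c s j b) (ℕ.+-suc i a) ⟨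
    (step + pathCost c s (suc i) a) + pathCost c s (i +ℕ suc a) b ∎
    where
    open ≡-Reasoning
    step : ℚ
    step = c (s i) (s (suc i))

  pathCost-snoc : ∀ s i L →
    pathCost c s i (suc L) ≡ pathCost c s i L + c (s (i +ℕ L)) (s (i +ℕ suc L))
  pathCost-snoc s i L = begin
    pathCost c s i (suc L)
      ≡⟨ cong (pathCost c s i) (ℕ.+-comm 1 L) ⟩
    pathCost c s i (L +ℕ 1)
      ≡⟨ pathCost-+ s i L 1 ⟩
    pathCost c s i L + (c (s (i +ℕ L)) (s (suc (i +ℕ L))) + 0ℚ)
      ≡⟨ cong (pathCost c s i L +_) (ℚ.+-identityʳ _) ⟩
    pathCost c s i L + c (s (i +ℕ L)) (s (suc (i +ℕ L)))
      ≡⟨ cong (λ j → pathCost c s i L + c (s (i +ℕ L)) (s j)) (ℕ.+-suc i L) ⟨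
    pathCost c s i L + c (s (i +ℕ L)) (s (i +ℕ suc L)) ∎
    where open ≡-Reasoning

  pathCost-cong : ∀ f g a b L → (∀ l → l ≤ℕ L → f (a +ℕ l) ≡ g (b +ℕ l)) →
    pathCost c f a L ≡ pathCost c g b L
  pathCost-cong f g a b zero agree = refl
  pathCost-cong f g a b (suc L) agree =
    cong₂ _+_ (cong₂ c (at 0 z≤n) (at 1 (s≤s z≤n))) (pathCost-cong f g (suc a) (suc b) L agree′)
    where
    at : ∀ l → l ≤ℕ suc L → f (l +ℕ a) ≡ g (l +ℕ b)
    at l l≤ = trans (cong f (ℕ.+-comm l a)) (trans (agree l l≤) (cong g (ℕ.+-comm b l)))
    agree′ : ∀ l → l ≤ℕ L → f (suc a +ℕ l) ≡ g (suc b +ℕ l)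
    agree′ l l≤L = trans (cong f (sym (ℕ.+-suc a l)))
      (trans (agree (suc l) (s≤s l≤L)) (cong g (ℕ.+-suc b l)))

  pathCost-periodic : ∀ s P → (∀ j → s (j +ℕ P) ≡ s j) → ∀ i → pathCost c s i P ≡ pathCost c s 0 P
  pathCost-periodic s P per zero = refl
  pathCost-periodic s P per (suc i) = trans shift (pathCost-periodic s P per i)
    where
    open ≡-Reasoning
    step : ℚ
    step = c (s i) (s (suc i))
    shift : pathCost c s (suc i) P ≡ pathCost c s i P
    shift = ∙-cancelˡ step _ _ (begin
      step + pathCost c s (suc i) P
        ≡⟨ pathCost-snoc s i P ⟩
      pathCost c s i P + c (s (i +ℕ P)) (s (i +ℕ suc P))
        ≡⟨ cong₂ (λ u v → pathCost c s i P + c u v)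
                 (per i) (trans (cong s (ℕ.+-suc i P)) (per (suc i))) ⟩
      pathCost c s i P + step
        ≡⟨ ℚ.+-comm _ step ⟩
      step + pathCost c s i P ∎)

  pathCost-shortcut : (∀ u v w → c u w ≤ c u v + c v w) → ∀ s i L →
    pathCost c s i L + c (s (i +ℕ L)) (s (i +ℕ suc (suc L))) ≤ pathCost c s i (suc (suc L))
  pathCost-shortcut tri s i L = begin
    pathCost c s i L + c x z
      ≤⟨ ℚ.+-monoʳ-≤ (pathCost c s i L) (tri x y z) ⟩
    pathCost c s i L + (c x y + c y z)
      ≡⟨ ℚ.+-assoc (pathCost c s i L) (c x y) (c y z) ⟨
    (pathCost c s i L + c x y) + c y z
      ≡⟨ cong (_+ c y z) (pathCost-snoc s i L) ⟨
    pathCost c s i (suc L) + c y z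
      ≡⟨ pathCost-snoc s i (suc L) ⟨
    pathCost c s i (suc (suc L)) ∎
    where
    open ℚ.≤-Reasoning
    x y z : Fin n
    x = s (i +ℕ L)
    y = s (i +ℕ suc L)
    z = s (i +ℕ suc (suc L))

  module _ (c≥0 : ∀ u v → 0ℚ ≤ c u v) where

    pathCost-nonneg : ∀ s i L → 0ℚ ≤ pathCost c s i L
    pathCost-nonneg s i zero = ℚ.≤-refl
    pathCost-nonneg s i (suc L) =
      ℚ.+-mono-≤ (c≥0 (s i) (s (suc i))) (pathCost-nonneg s (suc i) L)

    pathCost-mono : ∀ s i {g L} → g ≤ℕ L → pathCost c s i g ≤ pathCost c s i L
    pathCost-mono s i {g} {L} g≤L = begin
      pathCost c s i g
        ≤⟨ ℚ.≤-reflexive (sym (ℚ.+-identityʳ (pathCost c s i g))) ⟩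
      pathCost c s i g + 0ℚ
        ≤⟨ ℚ.+-monoʳ-≤ (pathCost c s i g) (pathCost-nonneg s (i +ℕ g) (L ∸ g)) ⟩
      pathCost c s i g + pathCost c s (i +ℕ g) (L ∸ g)
        ≡⟨ pathCost-+ s i g (L ∸ g) ⟨
      pathCost c s i (g +ℕ (L ∸ g))
        ≡⟨ cong (pathCost c s i) (ℕ.m+[n∸m]≡n g≤L) ⟩
      pathCost c s i L ∎
      where open ℚ.≤-Reasoning

∃-entry : ∀ {P : ℕ → Set} → Decidable P → ∀ a d → ¬ P a → P (a +ℕ d) → ∃ λ p → ¬ P p × P (suc p)
∃-entry {P} P? a zero ¬Pa Pa+0 = ⊥-elim (¬Pa (subst P (ℕ.+-identityʳ a) Pa+0))
∃-entry {P} P? a (suc d) ¬Pa Pa+d with P? (suc a)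
... | yes P1+a = a , ¬Pa , P1+a
... | no ¬P1+a = ∃-entry P? (suc a) d ¬P1+a (subst P (ℕ.+-suc a d) Pa+d)

[q+j]%K≢q : ∀ {K q j} .{{_ : NonZero K}} → q <ℕ K → 0 <ℕ j → j <ℕ K → (q +ℕ j) % K ≢ q
[q+j]%K≢q {K} {q} {j} q<K 0<j j<K eq with q +ℕ j <? K
... | yes q+j<K = ℕ.<⇒≢ (ℕ.m<m+n q 0<j) (sym (trans (sym (m<n⇒m%n≡m q+j<K)) eq))
... | no q+j≮K = ℕ.<⇒≢ j<K (ℕ.+-cancelˡ-≡ q j K q+j≡q+K)
  where
  K≤q+j : K ≤ℕ q +ℕ j
  K≤q+j = ℕ.≮⇒≥ q+j≮K
  wrapped : q +ℕ j ∸ K ≡ q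
  wrapped = begin
    q +ℕ j ∸ K        ≡⟨ m<n⇒m%n≡m (ℕ.m<n+o⇒m∸n<o (q +ℕ j) K (ℕ.+-mono-< q<K j<K)) ⟨
    (q +ℕ j ∸ K) % K  ≡⟨ m≤n⇒[n∸m]%m≡n%m K≤q+j ⟩
    (q +ℕ j) % K      ≡⟨ eq ⟩
    q                 ∎
    where open ≡-Reasoning
  q+j≡q+K : q +ℕ j ≡ q +ℕ K
  q+j≡q+K = trans (sym (ℕ.m∸n+n≡m K≤q+j)) (cong (_+ℕ K) wrapped)

periodCost : ∀ {n k} → (Fin n → Fin n → ℚ) → ClosedWalk n k → ℚ
periodCost {k = k} c W = pathCost c (seq W) 0 k

RevisitBound-mono : ∀ {n k} (c : Fin n → Fin n → ℚ) (W : ClosedWalk n k) {r r′} →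
  r ≤ r′ → RevisitBound c W r → RevisitBound c W r′
RevisitBound-mono c W r≤r′ bound d i g 0<g at-i at-i+g between =
  ℚ.≤-trans (bound d i g 0<g at-i at-i+g between) r≤r′

RevisitBound-periodCost : ∀ {n k} .{{_ : NonZero k}} (c : Fin n → Fin n → ℚ) →
  (∀ u v → 0ℚ ≤ c u v) → (W : ClosedWalk n k) → RevisitBound c W (periodCost c W)
RevisitBound-periodCost {k = k} c c≥0 W d i g 0<g at-i at-i+g between with g ≤? k
... | yes g≤k = ℚ.≤-trans (pathCost-mono c c≥0 (seq W) i g≤k)
                  (ℚ.≤-reflexive (pathCost-periodic c (seq W) k (periodic W) i))
... | no g≰k = ⊥-elim (between k (>-nonZero⁻¹ k) (ℕ.≰⇒> g≰k) (trans (periodic W i) at-i))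

module WalkProperties {n K : ℕ} .{{_ : NonZero K}} (W : ClosedWalk n K) where

  s : ℕ → Fin n
  s = seq W

  periodic-* : ∀ i t → s (i +ℕ t * K) ≡ s i
  periodic-* i zero = cong s (ℕ.+-identityʳ i)
  periodic-* i (suc t) = begin
    s (i +ℕ (K +ℕ t * K))  ≡⟨ cong (λ j → s (i +ℕ j)) (ℕ.+-comm K (t * K)) ⟩
    s (i +ℕ (t * K +ℕ K))  ≡⟨ cong s (ℕ.+-assoc i (t * K) K) ⟨
    s (i +ℕ t * K +ℕ K)    ≡⟨ periodic W (i +ℕ t * K) ⟩
    s (i +ℕ t * K)         ≡⟨ periodic-* i t ⟩
    s i                    ∎
    where open ≡-Reasoning

  periodic-% : ∀ i → s i ≡ s (i % K)
  periodic-% i = trans (cong s (m≡m%n+[m/n]*n i K)) (periodic-* (i % K) (i / K))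

  noStay-everywhere : ∀ i → s i ≢ s (suc i)
  noStay-everywhere i eq = noStay W (i % K) (m%n<n i K) (begin
    s (i % K)                      ≡⟨ periodic-% i ⟨
    s i                            ≡⟨ eq ⟩
    s (suc i)                      ≡⟨ cong (s ∘ suc) (m≡m%n+[m/n]*n i K) ⟩
    s (suc (i % K) +ℕ i / K * K)   ≡⟨ periodic-* (suc (i % K)) (i / K) ⟩
    s (suc (i % K))                ∎)
    where open ≡-Reasoning

  occurs-in-window : ∀ b i → ∃ λ j → j <ℕ K × s (b +ℕ j) ≡ s i
  occurs-in-window zero i = i % K , m%n<n i K , sym (periodic-% i)
  occurs-in-window (suc b) i with occurs-in-window b i
  ... | suc j , 1+j<K , eq = j , ℕ.<⇒≤ 1+j<K , trans (cong s (sym (ℕ.+-suc b j))) eq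
  ... | zero , _ , eq = pred K , ℕ.≤-reflexive (ℕ.suc-pred K) , (begin
    s (suc b +ℕ pred K)   ≡⟨ cong s (ℕ.+-suc b (pred K)) ⟨
    s (b +ℕ suc (pred K)) ≡⟨ cong (λ j → s (b +ℕ j)) (ℕ.suc-pred K) ⟩
    s (b +ℕ K)            ≡⟨ periodic W b ⟩
    s b                   ≡⟨ cong s (ℕ.+-identityʳ b) ⟨
    s (b +ℕ 0)            ≡⟨ eq ⟩
    s i                   ∎)
    where open ≡-Reasoning

  Recurs : ℕ → Set
  Recurs i = ∃ λ j → j <ℕ K × (0 <ℕ j × s (i +ℕ j) ≡ s i)

  recurs? : Decidable Recurs
  recurs? i = ℕ.anyUpTo? (λ j → (0 <? j) ×-dec (s (i +ℕ j) Fin.≟ s i)) K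

  recurs-+K : ∀ {i} → Recurs i → Recurs (i +ℕ K)
  recurs-+K {i} (j , j<K , 0<j , eq) = j , j<K , 0<j , (begin
    s (i +ℕ K +ℕ j)  ≡⟨ cong s (ℕ.+-assoc i K j) ⟩
    s (i +ℕ (K +ℕ j)) ≡⟨ cong (λ x → s (i +ℕ x)) (ℕ.+-comm K j) ⟩
    s (i +ℕ (j +ℕ K)) ≡⟨ cong s (ℕ.+-assoc i j K) ⟨
    s (i +ℕ j +ℕ K)  ≡⟨ periodic W (i +ℕ j) ⟩
    s (i +ℕ j)       ≡⟨ eq ⟩
    s i              ≡⟨ periodic W i ⟨
    s (i +ℕ K)       ∎)
    where open ≡-Reasoning

  recurs⇒occurs-strictly-in-window : ∀ {m} → Recurs m → ∀ i →
    ∃ λ j → j <ℕ K × (0 <ℕ j × s (m +ℕ j) ≡ s i)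
  recurs⇒occurs-strictly-in-window {m} (j′ , j′<K , 0<j′ , recur) i with occurs-in-window m i
  ... | suc j , j<K , eq = suc j , j<K , s≤s z≤n , eq
  ... | zero , _ , eq = j′ , j′<K , 0<j′ , trans recur (trans (cong s (sym (ℕ.+-identityʳ m))) eq)

  recurs-exists : n <ℕ K → ∃ Recurs
  recurs-exists n<K with Fin.pigeonhole n<K (s ∘ toℕ)
  ... | a , b , a<b , eq = toℕ a , toℕ b ∸ toℕ a ,
    ℕ.≤-<-trans (ℕ.m∸n≤m (toℕ b) (toℕ a)) (Fin.toℕ<n b) ,
    ℕ.m<n⇒0<n∸m a<b ,
    trans (cong s (ℕ.m+[n∸m]≡n (ℕ.<⇒≤ a<b))) (sym eq)

  module _ (recur : ∀ a → a <ℕ K → Recurs a) where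

    first : Fin n → ℕ
    first d = proj₁ (covers W d)

    first<K : ∀ d → first d <ℕ K
    first<K d = proj₁ (proj₂ (covers W d))

    visit : Fin n ⊎ Fin n → Fin K
    visit (inj₁ d) = fromℕ< (first<K d)
    visit (inj₂ d) = fromℕ< (m%n<n (first d +ℕ proj₁ (recur (first d) (first<K d))) K)

    visit-target : ∀ x → s (toℕ (visit x)) ≡ reduce x
    visit-target (inj₁ d) = trans (cong s (Fin.toℕ-fromℕ< (first<K d))) (proj₂ (proj₂ (covers W d)))
    visit-target (inj₂ d) with recur (first d) (first<K d)
    ... | j , _ , _ , recurrence = begin
      s (toℕ (fromℕ< (m%n<n (first d +ℕ j) K)))
        ≡⟨ cong s (Fin.toℕ-fromℕ< (m%n<n (first d +ℕ j) K)) ⟩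
      s ((first d +ℕ j) % K)  ≡⟨ periodic-% (first d +ℕ j) ⟨
      s (first d +ℕ j)        ≡⟨ recurrence ⟩
      s (first d)             ≡⟨ proj₂ (proj₂ (covers W d)) ⟩
      d                       ∎
      where open ≡-Reasoning

    same-target : ∀ x y → visit x ≡ visit y → reduce x ≡ reduce y
    same-target x y eq = trans (sym (visit-target x)) (trans (cong (s ∘ toℕ) eq) (visit-target y))

    visit-inj₁≢inj₂ : ∀ d → toℕ (visit (inj₁ d)) ≢ toℕ (visit (inj₂ d))
    visit-inj₁≢inj₂ d eq with recur (first d) (first<K d)
    ... | j , j<K , 0<j , _ = [q+j]%K≢q (first<K d) 0<j j<K (begin
      (first d +ℕ j) % K                     ≡⟨ Fin.toℕ-fromℕ< (m%n<n (first d +ℕ j) K) ⟨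
      toℕ (fromℕ< (m%n<n (first d +ℕ j) K))  ≡⟨ eq ⟨
      toℕ (fromℕ< (first<K d))               ≡⟨ Fin.toℕ-fromℕ< (first<K d) ⟩
      first d                                ∎)
      where open ≡-Reasoning

    visit-injective : ∀ {x y} → visit x ≡ visit y → x ≡ y
    visit-injective {inj₁ d} {inj₁ d′} eq = cong inj₁ (same-target (inj₁ d) (inj₁ d′) eq)
    visit-injective {inj₂ d} {inj₂ d′} eq = cong inj₂ (same-target (inj₂ d) (inj₂ d′) eq)
    visit-injective {inj₁ d} {inj₂ d′} eq with same-target (inj₁ d) (inj₂ d′) eq
    ... | refl = ⊥-elim (visit-inj₁≢inj₂ d (cong toℕ eq))
    visit-injective {inj₂ d} {inj₁ d′} eq with same-target (inj₂ d) (inj₁ d′) eq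
    ... | refl = ⊥-elim (visit-inj₁≢inj₂ d (cong toℕ (sym eq)))

    all-recur⇒n+n≤K : n +ℕ n ≤ℕ K
    all-recur⇒n+n≤K =
      Fin.injective⇒≤ {f = visit ∘ splitAt n} (Injection.injective (↔⇒↣ Fin.+↔⊎) ∘ visit-injective)

  nonrecurs-exists : K <ℕ n +ℕ n → ∃ λ a → a <ℕ K × ¬ Recurs a
  nonrecurs-exists K<n+n with ℕ.anyUpTo? (¬? ∘ recurs?) K
  ... | yes found = found
  ... | no none = ⊥-elim (ℕ.<⇒≱ K<n+n (all-recur⇒n+n≤K all-recur))
    where
    all-recur : ∀ a → a <ℕ K → Recurs a
    all-recur a a<K = decidable-stable (recurs? a) (λ ¬recur → none (a , a<K , ¬recur))

  recurrence-entry : n <ℕ K → K <ℕ n +ℕ n → ∃ λ p → ¬ Recurs p × Recurs (suc p)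
  recurrence-entry n<K K<n+n with nonrecurs-exists K<n+n | recurs-exists n<K
  ... | a , a<K , ¬recur-a | q , recur-q =
    ∃-entry recurs? a (q +ℕ K ∸ a) ¬recur-a
      (subst Recurs (sym (ℕ.m+[n∸m]≡n a≤q+K)) (recurs-+K recur-q))
    where
    a≤q+K : a ≤ℕ q +ℕ K
    a≤q+K = ℕ.≤-trans (ℕ.<⇒≤ a<K) (ℕ.m≤n+m K q)

  periodCost≤nonrecurrent-revisit : ∀ {c r p} → ¬ Recurs p → RevisitBound c W r → periodCost c W ≤ r
  periodCost≤nonrecurrent-revisit {c} {r} {p} ¬recur bound =
    subst (_≤ r) (pathCost-periodic c s K (periodic W) p)
      (bound (s p) p K (>-nonZero⁻¹ K) refl (periodic W p)
        (λ l 0<l l<K eq → ¬recur (l , l<K , 0<l , eq)))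

module Shortcut {n ℓ : ℕ} (W′ : ClosedWalk n (suc (suc ℓ))) (1≤ℓ : 1 ≤ℕ ℓ) (p : ℕ)
  (p-once : ¬ WalkProperties.Recurs W′ p) (p+1-recurs : WalkProperties.Recurs W′ (suc p)) where

  open WalkProperties W′

  p+2 : ℕ
  p+2 = suc (suc p)

  -- W′ read from position p + 2 with one visit fewer per period: the visit at p + 1 + K is skipped.
  shortcut-seq : ℕ → Fin n
  shortcut-seq i = s (p+2 +ℕ i % suc ℓ)

  shortcut-seq-< : ∀ {j} → j <ℕ suc ℓ → shortcut-seq j ≡ s (p+2 +ℕ j)
  shortcut-seq-< j<1+ℓ = cong (λ x → s (p+2 +ℕ x)) (m<n⇒m%n≡m j<1+ℓ)

  shortcut-seq-periodic : ∀ i → shortcut-seq (i +ℕ suc ℓ) ≡ shortcut-seq i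
  shortcut-seq-periodic i = cong (λ x → s (p+2 +ℕ x)) ([m+n]%n≡m%n i (suc ℓ))

  shortcut-seq-last : shortcut-seq ℓ ≡ s p
  shortcut-seq-last = begin
    shortcut-seq ℓ          ≡⟨ shortcut-seq-< ℕ.≤-refl ⟩
    s (suc (suc (p +ℕ ℓ)))  ≡⟨ cong (s ∘ suc) (ℕ.+-suc p ℓ) ⟨
    s (suc (p +ℕ suc ℓ))    ≡⟨ cong s (ℕ.+-suc p (suc ℓ)) ⟨
    s (p +ℕ suc (suc ℓ))    ≡⟨ periodic W′ p ⟩
    s p                     ∎
    where open ≡-Reasoning

  shortcut-seq-wrap : shortcut-seq (suc ℓ) ≡ s (p+2 +ℕ suc (suc ℓ))
  shortcut-seq-wrap = begin
    shortcut-seq (suc ℓ)    ≡⟨ shortcut-seq-periodic 0 ⟩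
    s (p+2 +ℕ 0)            ≡⟨ cong s (ℕ.+-identityʳ p+2) ⟩
    s p+2                   ≡⟨ periodic W′ p+2 ⟨
    s (p+2 +ℕ suc (suc ℓ))  ∎
    where open ≡-Reasoning

  shortcut-noStay : ∀ i → i <ℕ suc ℓ → shortcut-seq i ≢ shortcut-seq (suc i)
  shortcut-noStay i (s≤s i≤ℓ) eq with ℕ.m≤n⇒m<n∨m≡n i≤ℓ
  ... | inj₁ i<ℓ = noStay-everywhere (p+2 +ℕ i) (begin
    s (p+2 +ℕ i)          ≡⟨ shortcut-seq-< (s≤s i≤ℓ) ⟨
    shortcut-seq i        ≡⟨ eq ⟩
    shortcut-seq (suc i)  ≡⟨ shortcut-seq-< (s≤s i<ℓ) ⟩
    s (p+2 +ℕ suc i)      ≡⟨ cong s (ℕ.+-suc p+2 i) ⟩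
    s (suc (p+2 +ℕ i))    ∎)
    where open ≡-Reasoning
  ... | inj₂ refl = p-once (2 , s≤s (s≤s 1≤ℓ) , s≤s z≤n , (begin
    s (p +ℕ 2)            ≡⟨ cong s (ℕ.+-comm p 2) ⟩
    s p+2                 ≡⟨ cong s (ℕ.+-identityʳ p+2) ⟨
    s (p+2 +ℕ 0)          ≡⟨ shortcut-seq-periodic 0 ⟨
    shortcut-seq (suc i)  ≡⟨ eq ⟨
    shortcut-seq i        ≡⟨ shortcut-seq-last ⟩
    s p                   ∎))
    where open ≡-Reasoning

  shortcut-covers : ∀ d → ∃ λ i → i <ℕ suc ℓ × shortcut-seq i ≡ d
  shortcut-covers d with covers W′ d
  ... | q , _ , at-q with recurs⇒occurs-strictly-in-window p+1-recurs q
  ...   | suc j , s≤s j<1+ℓ , _ , eq =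
    j , j<1+ℓ ,
    trans (shortcut-seq-< j<1+ℓ) (trans (cong s (sym (ℕ.+-suc (suc p) j))) (trans eq at-q))

  shortcut : ClosedWalk n (suc ℓ)
  shortcut = record
    { seq = shortcut-seq
    ; periodic = shortcut-seq-periodic
    ; noStay = shortcut-noStay
    ; covers = shortcut-covers
    }

  periodCost-shortcut : (c : Fin n → Fin n → ℚ) → (∀ u v w → c u w ≤ c u v + c v w) →
    periodCost c shortcut ≤ periodCost c W′
  periodCost-shortcut c tri = begin
    pathCost c shortcut-seq 0 (suc ℓ)
      ≡⟨ pathCost-snoc c shortcut-seq 0 ℓ ⟩
    pathCost c shortcut-seq 0 ℓ + c (shortcut-seq ℓ) (shortcut-seq (suc ℓ))
      ≡⟨ cong₂ _+_ (pathCost-cong c shortcut-seq s 0 p+2 ℓ (λ l l≤ℓ → shortcut-seq-< (s≤s l≤ℓ)))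
                   (cong₂ c (shortcut-seq-< ℕ.≤-refl) shortcut-seq-wrap) ⟩
    pathCost c s p+2 ℓ + c (s (p+2 +ℕ ℓ)) (s (p+2 +ℕ suc (suc ℓ)))
      ≤⟨ pathCost-shortcut c tri s p+2 ℓ ⟩
    pathCost c s p+2 (suc (suc ℓ))
      ≡⟨ pathCost-periodic c s (suc (suc ℓ)) (periodic W′) p+2 ⟩
    periodCost c W′ ∎
    where open ℚ.≤-Reasoning

k≤2n∸2⇒1+k<n+n : ∀ {n k} → 2 ≤ℕ n → k ≤ℕ 2 * n ∸ 2 → suc k <ℕ n +ℕ n
k≤2n∸2⇒1+k<n+n {n} {k} 2≤n k≤2n∸2 = begin
  2 +ℕ k             ≤⟨ ℕ.+-monoʳ-≤ 2 k≤2n∸2 ⟩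
  2 +ℕ (2 * n ∸ 2)   ≡⟨ ℕ.m+[n∸m]≡n (ℕ.≤-trans 2≤n (ℕ.m≤m+n n (n +ℕ 0))) ⟩
  2 * n              ≡⟨ cong (n +ℕ_) (ℕ.+-identityʳ n) ⟩
  n +ℕ n             ∎
  where open ℕ.≤-Reasoning

lemma9 : (n : ℕ) → 2 ≤ℕ n →
    (c : Fin n → Fin n → ℚ) →
    (∀ u → c u u ≡ 0ℚ) →
    (∀ u v → u ≢ v → 0ℚ < c u v) →
    (∀ u v w → c u w ≤ c u v + c v w) →
    (k : ℕ) → n ≤ℕ k → k ≤ℕ 2 * n ∸ 2 →
    OptRevisitLe c k (suc k)
lemma9 n 2≤n c c-refl c-pos tri zero n≤0 _ with ℕ.≤-trans 2≤n n≤0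
... | ()
lemma9 n 2≤n c c-refl c-pos tri (suc ℓ) n≤k k≤2n∸2 W′
  with WalkProperties.recurrence-entry W′ (s≤s n≤k) (k≤2n∸2⇒1+k<n+n 2≤n k≤2n∸2)
... | p , p-once , p+1-recurs =
  shortcut , λ r W′-bound → RevisitBound-mono c shortcut
    (ℚ.≤-trans (periodCost-shortcut c tri)
               (WalkProperties.periodCost≤nonrecurrent-revisit W′ p-once W′-bound))
    (RevisitBound-periodCost c c≥0 shortcut)
  where
  open Shortcut W′ (s≤s⁻¹ (ℕ.≤-trans 2≤n n≤k)) p p-once p+1-recurs
  c≥0 : ∀ u v → 0ℚ ≤ c u v
  c≥0 u v with u Fin.≟ v
  ... | yes refl = ℚ.≤-reflexive (sym (c-refl u))
  ... | no u≢v = ℚ.<⇒≤ (c-pos u v u≢v)
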